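{- Let $k\ge 1$ and let $(G,\sigma)$ be a signed bipartite graph. Then $(G,\sigma)$ admits a homomorphism to $(K_{k,k},M)$ if and only if it admits a homomorphism to $(K_{2k},M)$.
   Context: A signed graph $(G,\sigma)$ is a graph $G$ with a signature $\sigma:E(G)\to\{+,-\}$. The sign of a closed walk is the product of the signs of its edges (with multiplicity). A homomorphism of $(G,\sigma)$ to $(H,\pi)$ is a mapping of vertices and edges of $G$ to vertices and edges of $H$, respectively, preserving adjacencies and incidences and such that each closed walk has the same sign as its image. $(K_{2k},M)$ is the complete graph on $2k$ vertices in which the edges of a perfect matching $M$ are negative and all other edges positive; $(K_{k,k},M)$ is the complete bipartite graph $K_{k,k}$ in which the edges of a perfect matching $M$ are negative and all others positive (so $(K_{k,k},M)$ is a signed subgraph of $(K_{2k},M)$). -}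

module Defs where

open import Data.Nat using (ℕ)
open import Data.Fin using (Fin; _≟_)
open import Data.Bool using (Bool; true; false)
open import Data.Product using (_×_; _,_; proj₁; proj₂; Σ; ∃)
open import Data.Sign using (Sign; +; -; _*_)
open import Relation.Binary.PropositionalEquality using (_≡_; _≢_)
open import Relation.Nullary using (yes; no)
open import Level using (suc; zero)

-- A finite signed (multi)graph: vertices Fin n, edges Fin m, each edge
-- has two end vertices and a sign.  Parallel edges are allowed.
record SignedGraph : Set where
  field
    nV   : ℕ
    nE   : ℕ
    endA : Fin nE → Fin nV
    endB : Fin nE → Fin nV
    σ    : Fin nE → Sign

open SignedGraph public

tail : (G : SignedGraph) → Bool → Fin (nE G) → Fin (nV G)
tail G true  e = endA G e
tail G false e = endB G e

head : (G : SignedGraph) → Bool → Fin (nE G) → Fin (nV G)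
head G true  e = endB G e
head G false e = endA G e

data Walk (G : SignedGraph) : Fin (nV G) → Fin (nV G) → Set where
  []   : ∀ {x} → Walk G x x
  step : ∀ {y} (e : Fin (nE G)) (d : Bool) →
         Walk G (head G d e) y → Walk G (tail G d e) y

walkSign : (G : SignedGraph) → ∀ {x y} → Walk G x y → Sign
walkSign G []             = +
walkSign G (step e d w)   = σ G e * walkSign G w

-- A simple signed graph (used as homomorphism target): vertex set,
-- symmetric adjacency, and the sign of the (unique) edge between
-- two adjacent vertices.
record SimpleSignedGraph : Set₁ where
  field
    V   : Set
    Adj : V → V → Set
    sgn : V → V → Sign

open SimpleSignedGraph public

-- Sign of the image of a walk under a vertex map f (the edge map is
-- forced since the target is simple).
imageSign : (G : SignedGraph) (H : SimpleSignedGraph) → (Fin (nV G) → V H) →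
            ∀ {x y} → Walk G x y → Sign
imageSign G H f []           = +
imageSign G H f (step e d w) =
  sgn H (f (tail G d e)) (f (head G d e)) * imageSign G H f w

-- Homomorphism of signed graphs (G,σ) → (H,π): vertex map preserving
-- adjacency (each edge goes to an edge; to the unique one, H simple)
-- such that every closed walk has the same sign as its image.
IsHom : (G : SignedGraph) (H : SimpleSignedGraph) → (Fin (nV G) → V H) → Set
IsHom G H f =
  ((e : Fin (nE G)) → Adj H (f (endA G e)) (f (endB G e))) ×
  (∀ x (w : Walk G x x) → walkSign G w ≡ imageSign G H f w)

HasHom : SignedGraph → SimpleSignedGraph → Set
HasHom G H = Σ (Fin (nV G) → V H) (IsHom G H)

IsBipartite : SignedGraph → Set
IsBipartite G = ∃ λ (c : Fin (nV G) → Bool) → (e : Fin (nE G)) → c (endA G e) ≢ c (endB G e)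

-- Vertices of K_{2k}: pairs (i , b), i : Fin k, b : Bool.  The perfect
-- matching M is {(i,true),(i,false)}; an edge is negative iff it lies in M.
matchSign : ∀ {k} → Fin k × Bool → Fin k × Bool → Sign
matchSign (i , _) (j , _) with i ≟ j
... | yes _ = -
... | no  _ = +

K2k : ℕ → SimpleSignedGraph
K2k k = record { V = Fin k × Bool ; Adj = λ x y → x ≢ y ; sgn = matchSign }

Kkk : ℕ → SimpleSignedGraph
Kkk k = record { V = Fin k × Bool ; Adj = λ x y → proj₂ x ≢ proj₂ y ; sgn = matchSign }

-- A homomorphism into (K_{k,k}, M) is one into (K_{2k}, M), since K_{k,k} is
-- a signed subgraph. Conversely, given f into (K_{2k}, M) and a proper
-- 2-colouring c of G, send v to (i, c v) where f v = (i, _): the sign of an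
-- edge of (K_{2k}, M) depends only on the Fin k coordinates, so every walk
-- keeps its image sign, and since c is proper each edge now joins the two
-- sides of K_{k,k}.
module Submission where

open import Defs
open import Data.Nat using (ℕ; _≤_)
open import Data.Bool using (Bool)
open import Data.Fin using (Fin)
open import Data.Product using (_×_; _,_; proj₁; proj₂)
import Data.Sign as Sign
open import Function.Bundles using (_⇔_; mk⇔)
open import Relation.Binary.PropositionalEquality using (_≡_; refl; cong; cong₂; trans)

imageSign-cong : (G : SignedGraph) (H₁ H₂ : SimpleSignedGraph)
  (f : Fin (nV G) → V H₁) (g : Fin (nV G) → V H₂) →
  (∀ x y → sgn H₁ (f x) (f y) ≡ sgn H₂ (g x) (g y)) →
  ∀ {x y} (w : Walk G x y) → imageSign G H₁ f w ≡ imageSign G H₂ g w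
imageSign-cong G H₁ H₂ f g sgn-eq []           = refl
imageSign-cong G H₁ H₂ f g sgn-eq (step e d w) =
  cong₂ Sign._*_ (sgn-eq (tail G d e) (head G d e))
                 (imageSign-cong G H₁ H₂ f g sgn-eq w)

IsHom-transfer : (G : SignedGraph) (H₁ H₂ : SimpleSignedGraph)
  (f : Fin (nV G) → V H₁) (g : Fin (nV G) → V H₂) →
  IsHom G H₁ f →
  ((e : Fin (nE G)) → Adj H₂ (g (endA G e)) (g (endB G e))) →
  (∀ x y → sgn H₁ (f x) (f y) ≡ sgn H₂ (g x) (g y)) →
  IsHom G H₂ g
IsHom-transfer G H₁ H₂ f g (_ , f-sign) g-adj sgn-eq =
  g-adj , λ x w → trans (f-sign x w) (imageSign-cong G H₁ H₂ f g sgn-eq w)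

Kkk-Adj⇒K2k-Adj : ∀ {k} {x y : Fin k × Bool} → Adj (Kkk k) x y → Adj (K2k k) x y
Kkk-Adj⇒K2k-Adj sides-differ x≡y = sides-differ (cong proj₂ x≡y)

HasHom-Kkk⇒HasHom-K2k : ∀ {k} (G : SignedGraph) → HasHom G (Kkk k) → HasHom G (K2k k)
HasHom-Kkk⇒HasHom-K2k {k} G (f , f-hom@(f-adj , _)) =
  f , IsHom-transfer G (Kkk k) (K2k k) f f f-hom
        (λ e → Kkk-Adj⇒K2k-Adj (f-adj e)) (λ _ _ → refl)

withSide : ∀ {n k} → (Fin n → Fin k × Bool) → (Fin n → Bool) → Fin n → Fin k × Bool
withSide f c v = proj₁ (f v) , c v

HasHom-K2k⇒HasHom-Kkk : ∀ {k} (G : SignedGraph) → IsBipartite G →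
  HasHom G (K2k k) → HasHom G (Kkk k)
HasHom-K2k⇒HasHom-Kkk {k} G (c , c-proper) (f , f-hom) =
  withSide f c , IsHom-transfer G (K2k k) (Kkk k) f (withSide f c) f-hom
                   c-proper (λ _ _ → refl)

theorem2p4 : (k : ℕ) → 1 ≤ k → (G : SignedGraph) → IsBipartite G →
    HasHom G (Kkk k) ⇔ HasHom G (K2k k)
theorem2p4 k _ G bipartite =
  mk⇔ (HasHom-Kkk⇒HasHom-K2k G) (HasHom-K2k⇒HasHom-Kkk G bipartite)
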